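{- Let $G$ be a graph, let $H$ be a connected subgraph of $G$, and let $\phi$ be an $H$-extensible chain on $G$. Let $f$ be an edge of $\partial_G(H)\setminus Z(\phi)$ and let $x,y$ be two distinct non-zero elements of $\mathbb{Z}_2\times\mathbb{Z}_2$ with $\phi(f)\in\{x,y\}$. Then there exist an edge $f'$ with $\phi(f')\in\{x,y\}$ such that the multiset $\{f,f'\}$ is a submultiset of the multiset $\partial_G(H)\setminus Z(\phi)$, and an $H$-extensible chain $\phi'$ that is an $H$-modification of $\phi$, such that $\phi'(e)=\phi(e)$ for all $e\in\partial_G(H)\setminus\{f,f'\}$ and $\phi'(e)=\phi(e)+x+y$ for $e\in\{f,f'\}$.
   Context: Graphs are finite and may have parallel edges. Let $\mathbb{Z}_2\times\mathbb{Z}_2$ have identity $0$. For a vertex $v$, $\partial_G(v)$ is the set of edges with exactly one end at $v$. For a subgraph $H$ of $G$, $\partial_G(H)$ is the multiset of edges of $E(G)\setminus E(H)$ in which each edge appears as many times as the number of its endvertices in $V(H)$ (so an edge with both ends in $V(H)$ but not in $E(H)$ appears twice); for a multiset $A$ and a set $B$, $A\setminus B$ keeps the elements of $A$ not in $B$ with their multiplicities. A chain on $G$ is a function $\phi:E(G)\to\mathbb{Z}_2\times\mathbb{Z}_2$; $Z(\phi)=\{e:\phi(e)=0\}$. A vertex $v$ is zero-sum in $\phi$ if $\sum_{e\in\partial_G(v)}\phi(e)=0$. For a connected subgraph $H$, a chain $\phi$ is $H$-extensible if every vertex of $V(G)\setminus V(H)$ is zero-sum in $\phi$, and an $H$-extensible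 chain $\phi'$ is an $H$-modification of $\phi$ if $Z(\phi)\setminus E(H)=Z(\phi')\setminus E(H)$. -}

module Defs where

open import Data.Nat using (ℕ; zero; suc; _+_; _≤_)
open import Data.Bool using (Bool; true; false; _xor_; if_then_else_; _∧_; not)
open import Data.Product using (_×_; _,_; proj₁; proj₂)
open import Data.Fin using (Fin; _≟_)
open import Data.List using (List; foldr; allFin)
open import Relation.Nullary using (¬_; does)
open import Relation.Binary.PropositionalEquality using (_≡_)

Z2² : Set
Z2² = Bool × Bool

0ᶻ : Z2²
0ᶻ = false , false

infixl 6 _⊕_
_⊕_ : Z2² → Z2² → Z2²
(a , b) ⊕ (c , d) = (a xor c) , (b xor d)

-- Finite graphs with parallel edges (and loops allowed):
-- vertices Fin n, edges Fin m, each edge has an (unordered) pair of ends.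

record Graph : Set where
  field
    n    : ℕ
    m    : ℕ
    ends : Fin m → Fin n × Fin n

open Graph public

Vtx : Graph → Set
Vtx G = Fin (n G)

Edge : Graph → Set
Edge G = Fin (m G)

end₁ end₂ : (G : Graph) → Edge G → Vtx G
end₁ G e = proj₁ (ends G e)
end₂ G e = proj₂ (ends G e)

_==_ : ∀ {k} → Fin k → Fin k → Bool
a == b = does (a ≟ b)

record Subgraph (G : Graph) : Set where
  field
    inV : Vtx G → Bool
    inE : Edge G → Bool
    closed : ∀ e → inE e ≡ true →
             (inV (end₁ G e) ≡ true) × (inV (end₂ G e) ≡ true)

open Subgraph public

data Walk {G : Graph} (H : Subgraph G) : Vtx G → Vtx G → Set where
  here : ∀ {u} → Walk H u u
  step₁ : ∀ {v} (e : Edge G) → inE H e ≡ true →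
          Walk H (end₂ G e) v → Walk H (end₁ G e) v
  step₂ : ∀ {v} (e : Edge G) → inE H e ≡ true →
          Walk H (end₁ G e) v → Walk H (end₂ G e) v

record Connected {G : Graph} (H : Subgraph G) : Set where
  field
    nonempty : Data.Product.∃ λ v → inV H v ≡ true
    walks    : ∀ u v → inV H u ≡ true → inV H v ≡ true → Walk H u v

Chain : Graph → Set
Chain G = Edge G → Z2²

inδ : (G : Graph) → Vtx G → Edge G → Bool
inδ G v e = (end₁ G e == v) xor (end₂ G e == v)

δsum : (G : Graph) → Chain G → Vtx G → Z2²
δsum G φ v = foldr (λ e acc → (if inδ G v e then φ e else 0ᶻ) ⊕ acc) 0ᶻ (allFin (m G))

ZeroSum : (G : Graph) → Chain G → Vtx G → Set
ZeroSum G φ v = δsum G φ v ≡ 0ᶻ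

Extensible : {G : Graph} → Subgraph G → Chain G → Set
Extensible {G} H φ = ∀ v → inV H v ≡ false → ZeroSum G φ v

Modification : {G : Graph} → Subgraph G → Chain G → Chain G → Set
Modification {G} H φ φ' =
  Extensible H φ' ×
  (∀ e → inE H e ≡ false → (φ e ≡ 0ᶻ → φ' e ≡ 0ᶻ) × (φ' e ≡ 0ᶻ → φ e ≡ 0ᶻ))

-- multisets of edges as multiplicity functions

b2n : Bool → ℕ
b2n true = 1
b2n false = 0

-- multiplicity of e in ∂_G(H): 0 if e ∈ E(H), else number of ends in V(H)
δHmult : {G : Graph} → Subgraph G → Edge G → ℕ
δHmult {G} H e =
  if inE H e then 0 else b2n (inV H (end₁ G e)) + b2n (inV H (end₂ G e))

δHZmult : {G : Graph} → Subgraph G → Chain G → Edge G → ℕ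
δHZmult {G} H φ e with φ e
... | (false , false) = 0
... | _               = δHmult H e

pairMult : {G : Graph} → Edge G → Edge G → Edge G → ℕ
pairMult f f' e = b2n (e == f) + b2n (e == f')

module Submission where

-- Put z = x + y.  The linear form det(z, ·) : Z₂² → Z₂ has kernel {0, z}, so
-- it takes the value 1 exactly on {x, y}.  Applying it to the zero-sum
-- condition shows that every vertex outside H meets an even number of edges e
-- with φ(e) ∈ {x, y}.  Hence a trail of such edges that
-- starts with f and enters the outside of H can always be continued without
-- reusing an edge until it returns to H through an edge f' (if both ends of f
-- lie in H, take f' = f).  Adding z to φ along the trail keeps every vertex
-- outside H zero-sum, swaps the values x and y (so no zero is created or
-- destroyed), and changes φ on ∂(H) only at f and f'.

open import Defs
open import Algebra.Bundles using (CommutativeRing)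
open import Data.Bool using (Bool; true; false; _xor_; _∧_; _∨_; not; if_then_else_)
open import Data.Bool.Properties
  using (xor-assoc; xor-comm; xor-identityʳ; xor-same; ∧-comm; ∧-identityʳ; ∧-zeroʳ;
         ∧-distribʳ-xor; ∨-zeroʳ; not-¬; ¬-not; if-eta; xor-∧-commutativeRing)
open import Algebra.Properties.CommutativeSemigroup
  (CommutativeRing.+-commutativeSemigroup xor-∧-commutativeRing) using (interchange)
open import Data.Empty using (⊥-elim)
open import Data.Fin as Fin using (Fin; zero; suc; _≟_)
open import Data.List using (List; []; _∷_; foldr; tabulate; allFin)
open import Data.List.Properties using (foldr-cong; foldr-fusion)
open import Data.List.Membership.Propositional using (_∈_)
open import Data.List.Membership.Propositional.Properties using (∈-allFin)
open import Data.List.Relation.Unary.Any using (here; there)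
open import Data.Nat using (ℕ; zero; suc; _+_; _≤_; _<_; z≤n; s≤s)
open import Data.Nat.Properties using (≤-refl; ≤-reflexive; ≤-pred; <-≤-trans; +-mono-≤; +-mono-≤-<; n≮0)
open import Data.Product using (Σ; ∃; ∃₂; _×_; _,_)
open import Data.Sum using (_⊎_; inj₁; inj₂)
open import Relation.Nullary using (¬_; yes; no)
open import Relation.Nullary.Decidable using (dec-true; dec-false)
open import Relation.Binary.PropositionalEquality
  using (_≡_; _≢_; refl; sym; trans; cong; cong₂; subst; module ≡-Reasoning)

⊕-assoc : ∀ a b c → (a ⊕ b) ⊕ c ≡ a ⊕ (b ⊕ c)
⊕-assoc (a₁ , a₂) (b₁ , b₂) (c₁ , c₂) = cong₂ _,_ (xor-assoc a₁ b₁ c₁) (xor-assoc a₂ b₂ c₂)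

⊕-comm : ∀ a b → a ⊕ b ≡ b ⊕ a
⊕-comm (a₁ , a₂) (b₁ , b₂) = cong₂ _,_ (xor-comm a₁ b₁) (xor-comm a₂ b₂)

⊕-identityʳ : ∀ a → a ⊕ 0ᶻ ≡ a
⊕-identityʳ (a₁ , a₂) = cong₂ _,_ (xor-identityʳ a₁) (xor-identityʳ a₂)

⊕-self : ∀ a → a ⊕ a ≡ 0ᶻ
⊕-self (a₁ , a₂) = cong₂ _,_ (xor-same a₁) (xor-same a₂)

⊕-interchange : ∀ a b c d → (a ⊕ b) ⊕ (c ⊕ d) ≡ (a ⊕ c) ⊕ (b ⊕ d)
⊕-interchange (a₁ , a₂) (b₁ , b₂) (c₁ , c₂) (d₁ , d₂) =
  cong₂ _,_ (interchange a₁ b₁ c₁ d₁) (interchange a₂ b₂ c₂ d₂)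

det : Z2² → Z2² → Bool
det (z₁ , z₂) (a₁ , a₂) = (a₁ ∧ z₂) xor (a₂ ∧ z₁)

det-⊕ʳ : ∀ z a b → det z (a ⊕ b) ≡ det z a xor det z b
det-⊕ʳ (z₁ , z₂) (a₁ , a₂) (b₁ , b₂) =
  trans (cong₂ _xor_ (∧-distribʳ-xor z₂ a₁ b₁) (∧-distribʳ-xor z₁ a₂ b₂))
        (interchange (a₁ ∧ z₂) (b₁ ∧ z₂) (a₂ ∧ z₁) (b₂ ∧ z₁))

det-self : ∀ z → det z z ≡ false
det-self (z₁ , z₂) = trans (cong ((z₁ ∧ z₂) xor_) (∧-comm z₂ z₁)) (xor-same (z₁ ∧ z₂))

det-true⇒≢0 : ∀ z {a} → det z a ≡ true → a ≢ 0ᶻ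
det-true⇒≢0 z () refl

det-true⇒⊕≢0 : ∀ z {a} → det z a ≡ true → a ⊕ z ≢ 0ᶻ
det-true⇒⊕≢0 z {a} za =
  det-true⇒≢0 z (trans (det-⊕ʳ z a z) (cong₂ _xor_ za (det-self z)))

det-⊕-left : ∀ x y → x ≢ y → x ≢ 0ᶻ → y ≢ 0ᶻ → det (x ⊕ y) x ≡ true
det-⊕-left (false , false) _              _   x≢0 _   = ⊥-elim (x≢0 refl)
det-⊕-left _              (false , false) _   _   y≢0 = ⊥-elim (y≢0 refl)
det-⊕-left (false , true) (false , true)  x≢y _   _   = ⊥-elim (x≢y refl)
det-⊕-left (true , false) (true , false)  x≢y _   _   = ⊥-elim (x≢y refl)
det-⊕-left (true , true)  (true , true)   x≢y _   _   = ⊥-elim (x≢y refl)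
det-⊕-left (false , true) (true , _)      _   _   _   = refl
det-⊕-left (true , false) (_ , true)      _   _   _   = refl
det-⊕-left (true , true)  (false , true)  _   _   _   = refl
det-⊕-left (true , true)  (true , false)  _   _   _   = refl

det-⊕-true⇐ : ∀ x y {a} → x ≢ y → x ≢ 0ᶻ → y ≢ 0ᶻ → a ≡ x ⊎ a ≡ y → det (x ⊕ y) a ≡ true
det-⊕-true⇐ x y x≢y x≢0 y≢0 (inj₁ refl) = det-⊕-left x y x≢y x≢0 y≢0
det-⊕-true⇐ x y x≢y x≢0 y≢0 (inj₂ refl) =
  trans (cong (λ z → det z y) (⊕-comm x y)) (det-⊕-left y x (λ y≡x → x≢y (sym y≡x)) y≢0 x≢0)

det-⊕-true⇒ : ∀ x y a → x ≢ y → x ≢ 0ᶻ → y ≢ 0ᶻ → det (x ⊕ y) a ≡ true → a ≡ x ⊎ a ≡ y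
det-⊕-true⇒ (false , false) _              _ _   x≢0 _   _ = ⊥-elim (x≢0 refl)
det-⊕-true⇒ _              (false , false) _ _   _   y≢0 _ = ⊥-elim (y≢0 refl)
det-⊕-true⇒ (false , true) (false , true)  _ x≢y _   _   _ = ⊥-elim (x≢y refl)
det-⊕-true⇒ (true , false) (true , false)  _ x≢y _   _   _ = ⊥-elim (x≢y refl)
det-⊕-true⇒ (true , true)  (true , true)   _ x≢y _   _   _ = ⊥-elim (x≢y refl)
det-⊕-true⇒ _ _ (false , false) _ _ _ ()
det-⊕-true⇒ (false , true) (true , false) (false , true) _ _ _ _ = inj₁ refl
det-⊕-true⇒ (false , true) (true , false) (true , false) _ _ _ _ = inj₂ refl
det-⊕-true⇒ (false , true) (true , false) (true , true)  _ _ _ ()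
det-⊕-true⇒ (false , true) (true , true)  (false , true) _ _ _ _ = inj₁ refl
det-⊕-true⇒ (false , true) (true , true)  (true , true)  _ _ _ _ = inj₂ refl
det-⊕-true⇒ (false , true) (true , true)  (true , false) _ _ _ ()
det-⊕-true⇒ (true , false) (false , true) (true , false) _ _ _ _ = inj₁ refl
det-⊕-true⇒ (true , false) (false , true) (false , true) _ _ _ _ = inj₂ refl
det-⊕-true⇒ (true , false) (false , true) (true , true)  _ _ _ ()
det-⊕-true⇒ (true , false) (true , true)  (true , false) _ _ _ _ = inj₁ refl
det-⊕-true⇒ (true , false) (true , true)  (true , true)  _ _ _ _ = inj₂ refl
det-⊕-true⇒ (true , false) (true , true)  (false , true) _ _ _ ()
det-⊕-true⇒ (true , true)  (false , true) (true , true)  _ _ _ _ = inj₁ refl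
det-⊕-true⇒ (true , true)  (false , true) (false , true) _ _ _ _ = inj₂ refl
det-⊕-true⇒ (true , true)  (false , true) (true , false) _ _ _ ()
det-⊕-true⇒ (true , true)  (true , false) (true , true)  _ _ _ _ = inj₁ refl
det-⊕-true⇒ (true , true)  (true , false) (true , false) _ _ _ _ = inj₂ refl
det-⊕-true⇒ (true , true)  (true , false) (false , true) _ _ _ ()

sumᶻ : ∀ {A : Set} → List A → (A → Z2²) → Z2²
sumᶻ l a = foldr (λ e s → a e ⊕ s) 0ᶻ l

parity : ∀ {A : Set} → List A → (A → Bool) → Bool
parity l b = foldr (λ e s → b e xor s) false l

module _ {A : Set} where

  sumᶻ-cong : ∀ (l : List A) {a a′ : A → Z2²} → (∀ e → a e ≡ a′ e) → sumᶻ l a ≡ sumᶻ l a′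
  sumᶻ-cong l a≗a′ = foldr-cong (λ e s → cong (_⊕ s) (a≗a′ e)) refl l

  parity-cong : ∀ (l : List A) {b b′ : A → Bool} → (∀ e → b e ≡ b′ e) → parity l b ≡ parity l b′
  parity-cong l b≗b′ = foldr-cong (λ e s → cong (_xor s) (b≗b′ e)) refl l

  sumᶻ-⊕ : ∀ (l : List A) a b → sumᶻ l (λ e → a e ⊕ b e) ≡ sumᶻ l a ⊕ sumᶻ l b
  sumᶻ-⊕ []      a b = refl
  sumᶻ-⊕ (e ∷ l) a b =
    trans (cong ((a e ⊕ b e) ⊕_) (sumᶻ-⊕ l a b)) (⊕-interchange (a e) (b e) (sumᶻ l a) (sumᶻ l b))

  parity-xor : ∀ (l : List A) a b → parity l (λ e → a e xor b e) ≡ parity l a xor parity l b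
  parity-xor []      a b = refl
  parity-xor (e ∷ l) a b =
    trans (cong ((a e xor b e) xor_) (parity-xor l a b)) (interchange (a e) (b e) (parity l a) (parity l b))

  det-sumᶻ : ∀ z (l : List A) a → det z (sumᶻ l a) ≡ parity l (λ e → det z (a e))
  det-sumᶻ z l a = foldr-fusion (det z) 0ᶻ (λ e s → det-⊕ʳ z (a e) s) l

  sumᶻ-scaled : ∀ z (l : List A) b → sumᶻ l (λ e → if b e then z else 0ᶻ) ≡ (if parity l b then z else 0ᶻ)
  sumᶻ-scaled z l b = sym (foldr-fusion (λ c → if c then z else 0ᶻ) false scale-xor l)
    where
    scale-xor : ∀ e s → (if b e xor s then z else 0ᶻ) ≡ (if b e then z else 0ᶻ) ⊕ (if s then z else 0ᶻ)
    scale-xor e s with b e | s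
    ... | false | _     = refl
    ... | true  | false = sym (⊕-identityʳ z)
    ... | true  | true  = sym (⊕-self z)

  parity-true⇒∃ : ∀ (l : List A) b → parity l b ≡ true → ∃ λ e → b e ≡ true
  parity-true⇒∃ (e ∷ l) b odd with b e in be
  ... | true  = e , be
  ... | false = parity-true⇒∃ l b odd

  parity-false : ∀ (l : List A) → parity l (λ _ → false) ≡ false
  parity-false []      = refl
  parity-false (_ ∷ l) = parity-false l

parity-tabulate : ∀ {A : Set} {n} (t : Fin n → A) b → parity (tabulate t) b ≡ parity (allFin n) (λ i → b (t i))
parity-tabulate {n = zero}  t b = refl
parity-tabulate {n = suc n} t b = cong (b (t zero) xor_)
  (trans (parity-tabulate (λ i → t (suc i)) b) (sym (parity-tabulate (Fin.suc {n}) (λ i → b (t i)))))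

==-refl : ∀ {k} (a : Fin k) → a == a ≡ true
==-refl a = dec-true (a ≟ a) refl

==⇒≡ : ∀ {k} {a b : Fin k} → a == b ≡ true → a ≡ b
==⇒≡ {a = a} {b} a==b with a ≟ b
... | yes a≡b = a≡b

≢⇒==false : ∀ {k} {a b : Fin k} → a ≢ b → a == b ≡ false
≢⇒==false {a = a} {b} = dec-false (a ≟ b)

==-sym : ∀ {k} (a b : Fin k) → a == b ≡ b == a
==-sym a b with a ≟ b | b ≟ a
... | yes _   | yes _   = refl
... | no _    | no _    = refl
... | yes a≡b | no b≢a  = ⊥-elim (b≢a (sym a≡b))
... | no a≢b  | yes b≡a = ⊥-elim (a≢b (sym b≡a))

parity-indicator : ∀ {k} (g : Fin k) (c : Fin k → Bool) → parity (allFin k) (λ e → (e == g) ∧ c e) ≡ c g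
-- Both clauses rely on suc i == zero reducing to false and suc i == suc g to i == g.
parity-indicator {suc k} zero c = begin
  c zero xor parity (tabulate suc) (λ e → (e == zero) ∧ c e)
    ≡⟨ cong (c zero xor_) (parity-tabulate (Fin.suc {k}) (λ e → (e == zero) ∧ c e)) ⟩
  c zero xor parity (allFin k) (λ _ → false)
    ≡⟨ cong (c zero xor_) (parity-false (allFin k)) ⟩
  c zero xor false
    ≡⟨ xor-identityʳ (c zero) ⟩
  c zero
    ∎
  where open ≡-Reasoning
parity-indicator {suc k} (suc g) c =
  trans (parity-tabulate (Fin.suc {k}) (λ e → (e == suc g) ∧ c e)) (parity-indicator g (λ i → c (suc i)))

insert : ∀ {k} → Fin k → (Fin k → Bool) → Fin k → Bool
insert g S e = (e == g) ∨ S e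

insert-self : ∀ {k} (g : Fin k) S → insert g S g ≡ true
insert-self g S = cong (_∨ S g) (==-refl g)

insert-⊇ : ∀ {k} (g : Fin k) S e → S e ≡ true → insert g S e ≡ true
insert-⊇ g S e Se = trans (cong ((e == g) ∨_) Se) (∨-zeroʳ (e == g))

insert-elim : ∀ {k} (g : Fin k) S {e} → insert g S e ≡ true → e ≡ g ⊎ S e ≡ true
insert-elim g S {e} e∈ with e == g in e==g
... | true  = inj₁ (==⇒≡ e==g)
... | false = inj₂ e∈

insert-⊆ : ∀ {k} {S T : Fin k → Bool} {g} → (∀ e → S e ≡ true → T e ≡ true) → T g ≡ true →
           ∀ e → insert g S e ≡ true → T e ≡ true
insert-⊆ {S = S} {g = g} S⊆T Tg e e∈ with insert-elim g S e∈
... | inj₁ refl = Tg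
... | inj₂ e∈S  = S⊆T e e∈S

singleton-⊆ : ∀ {k} {T : Fin k → Bool} {g} → T g ≡ true → ∀ e → e == g ≡ true → T e ≡ true
singleton-⊆ {T = T} Tg e e==g = subst (λ e → T e ≡ true) (sym (==⇒≡ e==g)) Tg

#unmarked : ∀ {A : Set} → List A → (A → Bool) → ℕ
#unmarked l S = foldr (λ e n → b2n (not (S e)) + n) 0 l

b2n-not-∨-≤ : ∀ a s → b2n (not (a ∨ s)) ≤ b2n (not s)
b2n-not-∨-≤ true  s = z≤n
b2n-not-∨-≤ false s = ≤-refl

#unmarked-insert-≤ : ∀ {k} (l : List (Fin k)) g S → #unmarked l (insert g S) ≤ #unmarked l S
#unmarked-insert-≤ []      g S = z≤n
#unmarked-insert-≤ (e ∷ l) g S = +-mono-≤ (b2n-not-∨-≤ (e == g) (S e)) (#unmarked-insert-≤ l g S)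

#unmarked-insert-< : ∀ {k} {l : List (Fin k)} {g S} → g ∈ l → S g ≡ false →
                     #unmarked l (insert g S) < #unmarked l S
#unmarked-insert-< {l = g ∷ l} {S = S} (here refl) Sg rewrite ==-refl g | Sg =
  s≤s (#unmarked-insert-≤ l g S)
#unmarked-insert-< {l = e ∷ l} {g} {S} (there g∈l) Sg =
  +-mono-≤-< (b2n-not-∨-≤ (e == g) (S e)) (#unmarked-insert-< g∈l Sg)

δparity : (G : Graph) → (Edge G → Bool) → Vtx G → Bool
δparity G S u = parity (allFin (m G)) (λ e → S e ∧ inδ G u e)

shift : (G : Graph) → Chain G → Z2² → (Edge G → Bool) → Chain G
shift G φ z S e = φ e ⊕ (if S e then z else 0ᶻ)

module _ (G : Graph) where

  δsum-shift : ∀ (φ : Chain G) z S u → δsum G (shift G φ z S) u ≡ δsum G φ u ⊕ (if δparity G S u then z else 0ᶻ)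
  δsum-shift φ z S u = begin
    δsum G (shift G φ z S) u
      ≡⟨ sumᶻ-cong edges (λ e → restrict-shift (inδ G u e) (S e) (φ e)) ⟩
    sumᶻ edges (λ e → (if inδ G u e then φ e else 0ᶻ) ⊕ (if S e ∧ inδ G u e then z else 0ᶻ))
      ≡⟨ sumᶻ-⊕ edges (λ e → if inδ G u e then φ e else 0ᶻ) (λ e → if S e ∧ inδ G u e then z else 0ᶻ) ⟩
    δsum G φ u ⊕ sumᶻ edges (λ e → if S e ∧ inδ G u e then z else 0ᶻ)
      ≡⟨ cong (δsum G φ u ⊕_) (sumᶻ-scaled z edges (λ e → S e ∧ inδ G u e)) ⟩
    δsum G φ u ⊕ (if δparity G S u then z else 0ᶻ)   ∎
    where
    open ≡-Reasoning
    edges : List (Edge G)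
    edges = allFin (m G)
    restrict-shift : ∀ b s a → (if b then a ⊕ (if s then z else 0ᶻ) else 0ᶻ)
                             ≡ (if b then a else 0ᶻ) ⊕ (if s ∧ b then z else 0ᶻ)
    restrict-shift true  true  a = refl
    restrict-shift true  false a = refl
    restrict-shift false true  a = refl
    restrict-shift false false a = refl

  det-δsum : ∀ z (φ : Chain G) u → det z (δsum G φ u) ≡ δparity G (λ e → det z (φ e)) u
  det-δsum z φ u =
    trans (det-sumᶻ z (allFin (m G)) (λ e → if inδ G u e then φ e else 0ᶻ))
          (parity-cong (allFin (m G)) (λ e → det-restrict (inδ G u e) (φ e)))
    where
    det-restrict : ∀ b a → det z (if b then a else 0ᶻ) ≡ det z a ∧ b
    det-restrict true  a = sym (∧-identityʳ (det z a))
    det-restrict false a = sym (∧-zeroʳ (det z a))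

  δparity-singleton : ∀ g u → δparity G (_== g) u ≡ inδ G u g
  δparity-singleton g u = parity-indicator g (inδ G u)

  δparity-insert : ∀ {S} g → S g ≡ false → ∀ u → δparity G (insert g S) u ≡ inδ G u g xor δparity G S u
  δparity-insert {S} g Sg u =
    trans (parity-cong edges (λ e → ∨-disjoint (e == g) (S e) (inδ G u e)
                                   (λ e==g → trans (cong S (==⇒≡ e==g)) Sg)))
          (trans (parity-xor edges (λ e → (e == g) ∧ inδ G u e) (λ e → S e ∧ inδ G u e))
                 (cong (_xor δparity G S u) (parity-indicator g (inδ G u))))
    where
    edges : List (Edge G)
    edges = allFin (m G)
    ∨-disjoint : ∀ a s c → (a ≡ true → s ≡ false) → (a ∨ s) ∧ c ≡ (a ∧ c) xor (s ∧ c)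
    ∨-disjoint true  s c a⇒¬s rewrite a⇒¬s refl = sym (xor-identityʳ c)
    ∨-disjoint false s c _ = refl

  δparity-odd⇒∃ : ∀ {S D v} → (∀ e → S e ≡ true → D e ≡ true) → δparity G D v ≡ false → δparity G S v ≡ true →
                  ∃ λ g → inδ G v g ≡ true × D g ≡ true × S g ≡ false
  δparity-odd⇒∃ {S} {D} {v} S⊆D D-even S-odd
    with parity-true⇒∃ edges (λ e → (D e xor S e) ∧ inδ G v e) differ
    where
    edges : List (Edge G)
    edges = allFin (m G)
    differ : parity edges (λ e → (D e xor S e) ∧ inδ G v e) ≡ true
    differ = trans (parity-cong edges (λ e → ∧-distribʳ-xor (inδ G v e) (D e) (S e)))
                   (trans (parity-xor edges (λ e → D e ∧ inδ G v e) (λ e → S e ∧ inδ G v e))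
                          (cong₂ _xor_ D-even S-odd))
  ... | g , found = g , classify (D g) (S g) (inδ G v g) (S⊆D g) found
    where
    classify : ∀ d s c → (s ≡ true → d ≡ true) → (d xor s) ∧ c ≡ true → c ≡ true × d ≡ true × s ≡ false
    classify true  false true  _   _ = refl , refl , refl
    classify false true  true  s⇒d _ with s⇒d refl
    ... | ()
    classify true  true  _     _   ()
    classify false false _     _   ()
    classify true  false false _   ()
    classify false true  false _   ()

Ends : (G : Graph) → Edge G → Vtx G → Vtx G → Set
Ends G e v w = (end₁ G e ≡ v × end₂ G e ≡ w) ⊎ (end₁ G e ≡ w × end₂ G e ≡ v)

BothEnds : (G : Graph) → (Vtx G → Bool) → Bool → Edge G → Set
BothEnds G X b e = X (end₁ G e) ≡ b × X (end₂ G e) ≡ b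

Crosses : (G : Graph) → (Vtx G → Bool) → Edge G → Set
Crosses G X e = ∃₂ λ v w → Ends G e v w × X v ≡ false × X w ≡ true

module _ (G : Graph) where

  inδ-Ends : ∀ {e v w} → Ends G e v w → ∀ u → inδ G u e ≡ (u == v) xor (u == w)
  inδ-Ends (inj₁ (refl , refl)) u = cong₂ _xor_ (==-sym _ u) (==-sym _ u)
  inδ-Ends (inj₂ (refl , refl)) u = trans (cong₂ _xor_ (==-sym _ u) (==-sym _ u)) (xor-comm (u == _) (u == _))

  other-end : ∀ {e v} → inδ G v e ≡ true → ∃ λ w → Ends G e v w
  other-end {e} {v} e∈∂v with end₁ G e ≟ v | end₂ G e ≟ v
  ... | yes e₁≡v | _        = end₂ G e , inj₁ (e₁≡v , refl)
  ... | no _     | yes e₂≡v = end₁ G e , inj₂ (refl , e₂≡v)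

  Ends-both : ∀ {e v w} (X : Vtx G → Bool) {b} → Ends G e v w → X v ≡ b → X w ≡ b → BothEnds G X b e
  Ends-both X (inj₁ (refl , refl)) Xv Xw = Xv , Xw
  Ends-both X (inj₂ (refl , refl)) Xv Xw = Xw , Xv

  separated : ∀ (X : Vtx G → Bool) {u w} → X u ≡ false → X w ≡ true → u == w ≡ false
  separated X {u} {w} Xu Xw = ≢⇒==false {a = u} {w} (λ u≡w → not-¬ Xu (trans (cong X u≡w) Xw))

  δparity-move : ∀ {S g v w} → S g ≡ false → Ends G g v w → ∀ {u} → δparity G S u ≡ (u == v) →
                 δparity G (insert g S) u ≡ (u == w)
  δparity-move {S} {g} {v} {w} g∉S ends {u} odd = begin
    δparity G (insert g S) u               ≡⟨ δparity-insert G g g∉S u ⟩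
    inδ G u g xor δparity G S u            ≡⟨ cong₂ _xor_ (inδ-Ends ends u) odd ⟩
    ((u == v) xor (u == w)) xor (u == v)   ≡⟨ xor-comm ((u == v) xor (u == w)) (u == v) ⟩
    (u == v) xor ((u == v) xor (u == w))   ≡⟨ sym (xor-assoc (u == v) (u == v) (u == w)) ⟩
    ((u == v) xor (u == v)) xor (u == w)   ≡⟨ cong (_xor (u == w)) (xor-same (u == v)) ⟩
    u == w                                 ∎
    where open ≡-Reasoning

module _ (G : Graph) (X : Vtx G → Bool) (D : Edge G → Bool) (f : Edge G) where

  record Trail : Set where
    field
      S                : Edge G → Bool
      last             : Edge G
      f∈S              : S f ≡ true
      last∈S           : S last ≡ true
      last≢f           : last ≢ f
      S⊆D              : ∀ e → S e ≡ true → D e ≡ true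
      interior-outside : ∀ e → S e ≡ true → e ≢ f → e ≢ last → BothEnds G X false e
      last-crosses     : Crosses G X last
      even             : ∀ u → X u ≡ false → δparity G S u ≡ false

  -- A trail from f through the outside of X is recorded by its edge set S; its
  -- current end v is the only vertex outside X of odd S-degree.
  record OpenTrail (S : Edge G → Bool) (v : Vtx G) : Set where
    field
      f∈S           : S f ≡ true
      S⊆D           : ∀ e → S e ≡ true → D e ≡ true
      rest-outside  : ∀ e → S e ≡ true → e ≢ f → BothEnds G X false e
      v-outside     : X v ≡ false
      odd-only-at-v : ∀ u → X u ≡ false → δparity G S u ≡ (u == v)

  module _ {S : Edge G → Bool} {v : Vtx G} (T : OpenTrail S v) {g : Edge G} {w : Vtx G}
           (Dg : D g ≡ true) (g∉S : S g ≡ false) (ends : Ends G g v w) where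
    open OpenTrail T

    close : X w ≡ true → Trail
    close Xw = record
      { S                = insert g S
      ; last             = g
      ; f∈S              = insert-⊇ g S f f∈S
      ; last∈S           = insert-self g S
      ; last≢f           = λ { refl → not-¬ g∉S f∈S }
      ; S⊆D              = insert-⊆ S⊆D Dg
      ; interior-outside = interior
      ; last-crosses     = v , w , ends , v-outside , Xw
      ; even             = λ u Xu → trans (δparity-move G g∉S ends (odd-only-at-v u Xu)) (separated G X Xu Xw)
      }
      where
      interior : ∀ e → insert g S e ≡ true → e ≢ f → e ≢ g → BothEnds G X false e
      interior e e∈ e≢f e≢g with insert-elim g S e∈
      ... | inj₁ e≡g = ⊥-elim (e≢g e≡g)
      ... | inj₂ e∈S = rest-outside e e∈S e≢f

    continue : X w ≡ false → OpenTrail (insert g S) w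
    continue Xw = record
      { f∈S           = insert-⊇ g S f f∈S
      ; S⊆D           = insert-⊆ S⊆D Dg
      ; rest-outside  = rest
      ; v-outside     = Xw
      ; odd-only-at-v = λ u Xu → δparity-move G g∉S ends (odd-only-at-v u Xu)
      }
      where
      rest : ∀ e → insert g S e ≡ true → e ≢ f → BothEnds G X false e
      rest e e∈ e≢f with insert-elim g S e∈
      ... | inj₁ refl = Ends-both G X ends v-outside Xw
      ... | inj₂ e∈S  = rest-outside e e∈S e≢f

  module _ (D-even : ∀ u → X u ≡ false → δparity G D u ≡ false) where

    extend : ∀ {S v} → OpenTrail S v →
             Trail ⊎ ∃₂ λ S′ w → OpenTrail S′ w × #unmarked (allFin (m G)) S′ < #unmarked (allFin (m G)) S
    extend {S} {v} T
      with δparity-odd⇒∃ G S⊆D (D-even v v-outside) (trans (odd-only-at-v v v-outside) (==-refl v))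
      where open OpenTrail T
    ... | g , g∈∂v , Dg , g∉S with other-end G g∈∂v
    ...   | w , ends with X w in Xw
    ...     | true  = inj₁ (close T Dg g∉S ends Xw)
    ...     | false = inj₂ (insert g S , w , continue T Dg g∉S ends Xw , #unmarked-insert-< (∈-allFin g) g∉S)

    walk : ∀ k {S v} → OpenTrail S v → #unmarked (allFin (m G)) S ≤ k → Trail
    walk k T bound with extend T
    walk k       T bound | inj₁ done = done
    walk zero    T bound | inj₂ (_ , _ , _ , fewer) = ⊥-elim (n≮0 (<-≤-trans fewer bound))
    walk (suc k) T bound | inj₂ (_ , _ , T′ , fewer) = walk k T′ (≤-pred (<-≤-trans fewer bound))

    trail : D f ≡ true → Crosses G X f → Trail
    trail Df (v , w , ends , Xv , Xw) = walk _ start ≤-refl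
      where
      start : OpenTrail (_== f) v
      start = record
        { f∈S           = ==-refl f
        ; S⊆D           = singleton-⊆ Df
        ; rest-outside  = λ e e==f e≢f → ⊥-elim (e≢f (==⇒≡ e==f))
        ; v-outside     = Xv
        ; odd-only-at-v = λ u Xu → begin
            δparity G (_== f) u         ≡⟨ δparity-singleton G f u ⟩
            inδ G u f                   ≡⟨ inδ-Ends G ends u ⟩
            (u == v) xor (u == w)       ≡⟨ cong ((u == v) xor_) (separated G X Xu Xw) ⟩
            (u == v) xor false          ≡⟨ xor-identityʳ (u == v) ⟩
            u == v                      ∎
        }
        where open ≡-Reasoning

module _ {G : Graph} (φ : Chain G) (z : Z2²) (S : Edge G → Bool) where

  shift-∈ : ∀ {e} → S e ≡ true → shift G φ z S e ≡ φ e ⊕ z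
  shift-∈ e∈S rewrite e∈S = refl

  shift-∉ : ∀ {e} → S e ≡ false → shift G φ z S e ≡ φ e
  shift-∉ {e} e∉S rewrite e∉S = ⊕-identityʳ (φ e)

  shift-extensible : (H : Subgraph G) → Extensible H φ → (∀ u → inV H u ≡ false → δparity G S u ≡ false) →
                     Extensible H (shift G φ z S)
  shift-extensible H φ-ext S-even u u∉H =
    trans (δsum-shift G φ z S u) (cong₂ _⊕_ (φ-ext u u∉H) (cong (λ b → if b then z else 0ᶻ) (S-even u u∉H)))

  shift-zeros : (∀ e → S e ≡ true → det z (φ e) ≡ true) →
                ∀ e → (φ e ≡ 0ᶻ → shift G φ z S e ≡ 0ᶻ) × (shift G φ z S e ≡ 0ᶻ → φ e ≡ 0ᶻ)
  shift-zeros S⊆D e with S e in e∈S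
  ... | true  = (λ φe≡0 → ⊥-elim (det-true⇒≢0 z (S⊆D e e∈S) φe≡0))
              , (λ φ′e≡0 → ⊥-elim (det-true⇒⊕≢0 z {φ e} (S⊆D e e∈S) φ′e≡0))
  ... | false = (λ φe≡0 → trans (⊕-identityʳ (φ e)) φe≡0) , (λ φ′e≡0 → trans (sym (⊕-identityʳ (φ e))) φ′e≡0)

module _ {G : Graph} (H : Subgraph G) where

  δHmult-outside : ∀ {e} → BothEnds G (inV H) false e → δHmult H e ≡ 0
  δHmult-outside {e} (out₁ , out₂) rewrite out₁ | out₂ = if-eta (inE H e)

  δHmult-chord : ∀ {e} → inE H e ≡ false → BothEnds G (inV H) true e → δHmult H e ≡ 2
  δHmult-chord e∉E (in₁ , in₂) rewrite e∉E | in₁ | in₂ = refl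

  crossing⇒∉E : ∀ {e} → Crosses G (inV H) e → inE H e ≡ false
  crossing⇒∉E {e} (v , w , ends , v∉H , _) with inE H e in e∈E
  ... | false = refl
  ... | true with closed H e e∈E | ends
  ...   | in₁ , _ | inj₁ (refl , _) = ⊥-elim (not-¬ v∉H in₁)
  ...   | _ , in₂ | inj₂ (_ , refl) = ⊥-elim (not-¬ v∉H in₂)

  crossing⇒δHmult : ∀ {e} → Crosses G (inV H) e → 1 ≤ δHmult H e
  crossing⇒δHmult c@(_ , _ , ends , v∉H , w∈H) rewrite crossing⇒∉E c with ends
  ... | inj₁ (refl , refl) rewrite v∉H | w∈H = ≤-refl
  ... | inj₂ (refl , refl) rewrite v∉H | w∈H = ≤-refl

  δHmult-positive : ∀ {e} → 1 ≤ δHmult H e → inE H e ≡ false × (BothEnds G (inV H) true e ⊎ Crosses G (inV H) e)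
  δHmult-positive {e} pos with inE H e in e∈E | inV H (end₁ G e) in X₁ | inV H (end₂ G e) in X₂
  ... | true  | _     | _     = ⊥-elim (n≮0 pos)
  ... | false | true  | true  = refl , inj₁ (refl , refl)
  ... | false | true  | false = refl , inj₂ (end₂ G e , end₁ G e , inj₂ (refl , refl) , X₂ , X₁)
  ... | false | false | true  = refl , inj₂ (end₁ G e , end₂ G e , inj₁ (refl , refl) , X₁ , X₂)
  ... | false | false | false = ⊥-elim (n≮0 pos)

  δHZmult-nonzero : ∀ (φ : Chain G) {e} → φ e ≢ 0ᶻ → δHZmult H φ e ≡ δHmult H e
  δHZmult-nonzero φ {e} φe≢0 with φ e
  ... | false , false = ⊥-elim (φe≢0 refl)
  ... | false , true  = refl
  ... | true  , _     = refl

pairMult-≤ : ∀ {G} {f f′ : Edge G} (μ : Edge G → ℕ) → f ≢ f′ → 1 ≤ μ f → 1 ≤ μ f′ →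
             ∀ e → pairMult {G} f f′ e ≤ μ e
pairMult-≤ {f = f} {f′} μ f≢f′ μf μf′ e with e ≟ f | e ≟ f′
... | yes refl | yes refl = ⊥-elim (f≢f′ refl)
... | yes refl | no _     = μf
... | no _     | yes refl = μf′
... | no _     | no _     = z≤n

pairMult-self-≤ : ∀ {G} {f : Edge G} (μ : Edge G → ℕ) → 2 ≤ μ f → ∀ e → pairMult {G} f f e ≤ μ e
pairMult-self-≤ {f = f} μ μf e with e ≟ f
... | yes refl = μf
... | no _     = z≤n

module _ {G : Graph} (H : Subgraph G) (φ : Chain G) (z : Z2²) where

  switchable : Edge G → Bool
  switchable e = det z (φ e)

  record Switching (f : Edge G) : Set where
    field
      last         : Edge G
      S            : Edge G → Bool
      f∈S          : S f ≡ true
      last∈S       : S last ≡ true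
      S-switchable : ∀ e → S e ≡ true → switchable e ≡ true
      off-boundary : ∀ e → S e ≡ true → e ≢ f → e ≢ last → δHmult H e ≡ 0
      even         : ∀ u → inV H u ≡ false → δparity G S u ≡ false
      on-boundary  : ∀ e → pairMult {G} f last e ≤ δHZmult H φ e

  from-trail : ∀ {f} → 1 ≤ δHZmult H φ f → Trail G (inV H) switchable f → Switching f
  from-trail f∈∂ T = record
    { last         = last
    ; S            = S
    ; f∈S          = f∈S
    ; last∈S       = last∈S
    ; S-switchable = S⊆D
    ; off-boundary = λ e e∈S e≢f e≢last → δHmult-outside H (interior-outside e e∈S e≢f e≢last)
    ; even         = even
    ; on-boundary  = pairMult-≤ {G} (δHZmult H φ) (λ f≡last → last≢f (sym f≡last)) f∈∂ last∈∂
    }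
    where
    open Trail T
    last∈∂ : 1 ≤ δHZmult H φ last
    last∈∂ = subst (1 ≤_) (sym (δHZmult-nonzero H φ (det-true⇒≢0 z (S⊆D last last∈S))))
                   (crossing⇒δHmult H last-crosses)

  from-chord : ∀ {f} → switchable f ≡ true → inE H f ≡ false → BothEnds G (inV H) true f → Switching f
  from-chord {f} Df f∉E (in₁ , in₂) = record
    { last         = f
    ; S            = _== f
    ; f∈S          = ==-refl f
    ; last∈S       = ==-refl f
    ; S-switchable = singleton-⊆ Df
    ; off-boundary = λ e e==f e≢f _ → ⊥-elim (e≢f (==⇒≡ e==f))
    ; even         = even
    ; on-boundary  = pairMult-self-≤ {G} (δHZmult H φ) (≤-reflexive (sym f∈∂₂))
    }
    where
    f∈∂₂ : δHZmult H φ f ≡ 2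
    f∈∂₂ = trans (δHZmult-nonzero H φ (det-true⇒≢0 z Df)) (δHmult-chord H f∉E (in₁ , in₂))
    even : ∀ u → inV H u ≡ false → δparity G (_== f) u ≡ false
    even u u∉H = begin
      δparity G (_== f) u                          ≡⟨ δparity-singleton G f u ⟩
      inδ G u f                                    ≡⟨ inδ-Ends G (inj₁ (refl , refl)) u ⟩
      (u == end₁ G f) xor (u == end₂ G f)          ≡⟨ cong₂ _xor_ (separated G (inV H) u∉H in₁) (separated G (inV H) u∉H in₂) ⟩
      false                                        ∎
      where open ≡-Reasoning

  switching : Extensible H φ → ∀ {f} → 1 ≤ δHZmult H φ f → switchable f ≡ true → Switching f
  switching φ-ext {f} f∈∂ Df
    with δHmult-positive H (subst (1 ≤_) (δHZmult-nonzero H φ (det-true⇒≢0 z Df)) f∈∂)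
  ... | f∉E , inj₁ chord   = from-chord Df f∉E chord
  ... | _   , inj₂ crosses = from-trail f∈∂ (trail G (inV H) switchable f D-even Df crosses)
    where
    D-even : ∀ u → inV H u ≡ false → δparity G switchable u ≡ false
    D-even u u∉H = trans (sym (det-δsum G z φ u)) (cong (det z) (φ-ext u u∉H))

lemma4 : (G : Graph) (H : Subgraph G) → Connected H →
         (φ : Chain G) → Extensible H φ →
         (f : Edge G) → 1 ≤ δHZmult H φ f →
         (x y : Z2²) → ¬ x ≡ y → ¬ x ≡ 0ᶻ → ¬ y ≡ 0ᶻ →
         (φ f ≡ x ⊎ φ f ≡ y) →
         Σ (Edge G) λ f' →
           (φ f' ≡ x ⊎ φ f' ≡ y) ×
           (∀ e → pairMult {G} f f' e ≤ δHZmult H φ e) ×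
           Σ (Chain G) λ φ' →
             Extensible H φ' ×
             Modification H φ φ' ×
             (∀ e → 1 ≤ δHmult H e → ¬ e ≡ f → ¬ e ≡ f' → φ' e ≡ φ e) ×
             (∀ e → (e ≡ f ⊎ e ≡ f') → φ' e ≡ φ e ⊕ x ⊕ y)
lemma4 G H _ φ φ-ext f f∈∂ x y x≢y x≢0 y≢0 φf∈xy =
  last , det-⊕-true⇒ x y (φ last) x≢y x≢0 y≢0 (S-switchable last last∈S) , on-boundary ,
  φ′ , φ′-ext , (φ′-ext , λ e _ → shift-zeros {G} φ z S S-switchable e) , unchanged , switched
  where
  z : Z2²
  z = x ⊕ y
  open Switching (switching H φ z φ-ext f∈∂ (det-⊕-true⇐ x y x≢y x≢0 y≢0 φf∈xy))
  φ′ : Chain G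
  φ′ = shift G φ z S
  φ′-ext : Extensible H φ′
  φ′-ext = shift-extensible {G} φ z S H φ-ext even
  unchanged : ∀ e → 1 ≤ δHmult H e → e ≢ f → e ≢ last → φ′ e ≡ φ e
  unchanged e e∈∂ e≢f e≢last =
    shift-∉ {G} φ z S (¬-not (λ e∈S → n≮0 (subst (1 ≤_) (off-boundary e e∈S e≢f e≢last) e∈∂)))
  switched : ∀ e → e ≡ f ⊎ e ≡ last → φ′ e ≡ φ e ⊕ x ⊕ y
  switched e (inj₁ refl) = trans (shift-∈ {G} φ z S f∈S) (sym (⊕-assoc (φ e) x y))
  switched e (inj₂ refl) = trans (shift-∈ {G} φ z S last∈S) (sym (⊕-assoc (φ e) x y))
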